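{- Let $G=(V,E)$ be a split graph. An edge $e\in E$ satisfies that $G-e$ is a split graph if and only if $e$ is neither the middle edge of an induced $P_4$ nor the middle edge of an induced diamond in $G$.
   Context: A split graph is a graph whose vertex set can be partitioned into a clique and an independent set. $P_4$ is the path on four vertices; its middle edge joins its two degree-two vertices. A diamond is $K_4$ minus an edge; its middle edge joins its two degree-three vertices. -}

module Defs where

open import Data.Nat using (ℕ)
open import Data.Fin using (Fin; _≟_)
open import Data.Bool using (Bool; true; false; _∧_; _∨_; if_then_else_)
open import Data.Product using (Σ; ∃; ∃-syntax; _×_; _,_)
open import Relation.Binary.PropositionalEquality using (_≡_; _≢_)
open import Relation.Nullary.Decidable using (⌊_⌋)

record Graph (n : ℕ) : Set where
  field
    adj   : Fin n → Fin n → Bool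
    sym   : ∀ x y → adj x y ≡ adj y x
    irrefl : ∀ x → adj x x ≡ false
open Graph public

_∼[_]_ : ∀ {n} → Fin n → Graph n → Fin n → Set
x ∼[ G ] y = adj G x y ≡ true

_≁[_]_ : ∀ {n} → Fin n → Graph n → Fin n → Set
x ≁[ G ] y = adj G x y ≡ false

IsSplit : ∀ {n} → Graph n → Set
IsSplit {n} G =
  Σ (Fin n → Bool) λ inK → ((∀ x y → x ≢ y → inK x ≡ true → inK y ≡ true → x ∼[ G ] y)
          × (∀ x y → inK x ≡ false → inK y ≡ false → x ≁[ G ] y))

samePair : ∀ {n} → Fin n → Fin n → Fin n → Fin n → Bool
samePair u v x y = (⌊ x ≟ u ⌋ ∧ ⌊ y ≟ v ⌋) ∨ (⌊ x ≟ v ⌋ ∧ ⌊ y ≟ u ⌋)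

deleteEdge : ∀ {n} → (G : Graph n) → (u v : Fin n) → Graph n
deleteEdge G u v = record
  { adj = λ x y → if samePair u v x y then false else adj G x y
  ; sym = symP
  ; irrefl = irr
  }
  where
  open import Data.Bool.Properties using (∧-comm; ∨-comm)
  open import Relation.Binary.PropositionalEquality using (refl; cong₂; trans)
  sp : ∀ x y → samePair u v x y ≡ samePair u v y x
  sp x y = trans (∨-comm (⌊ x ≟ u ⌋ ∧ ⌊ y ≟ v ⌋) (⌊ x ≟ v ⌋ ∧ ⌊ y ≟ u ⌋))
                 (cong₂ _∨_ (∧-comm ⌊ x ≟ v ⌋ ⌊ y ≟ u ⌋) (∧-comm ⌊ x ≟ u ⌋ ⌊ y ≟ v ⌋))
  symP : ∀ x y → (if samePair u v x y then false else adj G x y)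
               ≡ (if samePair u v y x then false else adj G y x)
  symP x y rewrite sp x y | Graph.sym G x y = refl
  irr : ∀ x → (if samePair u v x x then false else adj G x x) ≡ false
  irr x with samePair u v x x
  ... | true = refl
  ... | false = Graph.irrefl G x

MiddleEdgeOfInducedP4 : ∀ {n} → Graph n → Fin n → Fin n → Set
MiddleEdgeOfInducedP4 G u v =
  Σ (Fin _) λ a → Σ (Fin _) λ b →
    ( (a ≢ u × a ≢ v × a ≢ b × u ≢ v × u ≢ b × v ≢ b)
    × (a ∼[ G ] u × u ∼[ G ] v × v ∼[ G ] b)
    × (a ≁[ G ] v × a ≁[ G ] b × u ≁[ G ] b))

MiddleEdgeOfInducedDiamond : ∀ {n} → Graph n → Fin n → Fin n → Set
MiddleEdgeOfInducedDiamond G u v =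
  Σ (Fin _) λ a → Σ (Fin _) λ b →
    ( (a ≢ u × a ≢ v × a ≢ b × u ≢ v × u ≢ b × v ≢ b)
    × (u ∼[ G ] v × u ∼[ G ] a × u ∼[ G ] b × v ∼[ G ] a × v ∼[ G ] b)
    × a ≁[ G ] b)

module Submission where

-- Split graphs have no induced 2K₂ and no induced C₄. Deleting the middle edge
-- of an induced P₄ a-u-v-b leaves the 2K₂ {au, vb}; deleting the middle edge of
-- an induced diamond leaves the C₄ u-a-v-b. Conversely, let (K, I) be a split
-- partition of G. If u or v lies in I, (K, I) still splits G - uv. If u, v ∈ K
-- have a common neighbour c ∈ I, then c is adjacent to all of K (a non-neighbour
-- x ∈ K would give the diamond u, v, c, x), so c can be moved into K; afterwards
-- u and v have no common neighbour in I, since a second one c′ would give the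
-- diamond u, v, c, c′. Without common neighbours in I, either u or v has no
-- neighbour in I at all and can be moved out of K after deleting uv, or
-- neighbours a of u and b of v in I form the induced P₄ a-u-v-b.

open import Defs hiding (sym)
open import Data.Fin using (Fin; _≟_)
open import Data.Fin.Properties using (any?)
open import Data.Bool using (Bool; true; false; _∨_; if_then_else_)
import Data.Bool as Bool
open import Data.Bool.Properties using (∧-zeroʳ; not-¬; ¬-not)
open import Data.Vec.Functional using (Vector; updateAt)
open import Data.Vec.Functional.Properties using (updateAt-updates; updateAt-minimal)
open import Data.Sum using (_⊎_; inj₁; inj₂)
open import Data.Product using (∃; _×_; _,_; proj₁; proj₂)
open import Data.Empty using (⊥; ⊥-elim)
open import Function using (const; _∘_)
open import Function.Bundles using (_⇔_; mk⇔)
open import Relation.Unary using (Decidable)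
open import Relation.Nullary using (¬_; yes; no; contradiction)
open import Relation.Nullary.Decidable using (_×-dec_)
open import Relation.Binary.PropositionalEquality using (_≡_; _≢_; refl; sym; trans; cong; ≢-sym)

≢-by : ∀ {A : Set} (f : A → Bool) {x y : A} → f x ≡ true → f y ≡ false → x ≢ y
≢-by f fx≡true fy≡false refl = not-¬ fx≡true fy≡false

adjacent⇒≢ : ∀ {n} (G : Graph n) {x y : Fin n} → x ∼[ G ] y → x ≢ y
adjacent⇒≢ G x∼y refl = not-¬ x∼y (irrefl G _)

updateAt-const-≡ : ∀ {n} {A : Set} (f : Vector A n) (w x : Fin n) {b c : A} →
                   updateAt f w (const b) x ≡ c → (x ≡ w × b ≡ c) ⊎ (x ≢ w × f x ≡ c)
updateAt-const-≡ f w x fx≡c with x ≟ w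
... | yes refl = inj₁ (refl , trans (sym (updateAt-updates w f)) fx≡c)
... | no x≢w   = inj₂ (x≢w , trans (sym (updateAt-minimal x w f x≢w)) fx≡c)

IsCliquePart : ∀ {n} → Graph n → (Fin n → Bool) → Set
IsCliquePart G inK = ∀ x y → x ≢ y → inK x ≡ true → inK y ≡ true → x ∼[ G ] y

IsIndependentPart : ∀ {n} → Graph n → (Fin n → Bool) → Set
IsIndependentPart G inK = ∀ x y → inK x ≡ false → inK y ≡ false → x ≁[ G ] y

SplitPartition : ∀ {n} → Graph n → (Fin n → Bool) → Set
SplitPartition G inK = IsCliquePart G inK × IsIndependentPart G inK

IndependentNeighbour : ∀ {n} → Graph n → (Fin n → Bool) → Fin n → Fin n → Set
IndependentNeighbour G inK w a = inK a ≡ false × w ∼[ G ] a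

independentNeighbour? : ∀ {n} (G : Graph n) (inK : Fin n → Bool) (w : Fin n) →
                        Decidable (IndependentNeighbour G inK w)
independentNeighbour? G inK w a = (inK a Bool.≟ false) ×-dec (adj G w a Bool.≟ true)

no-independent-neighbour : ∀ {n} (G : Graph n) {inK : Fin n → Bool} {w : Fin n} →
                           ¬ ∃ (IndependentNeighbour G inK w) →
                           ∀ y → inK y ≡ false → w ≁[ G ] y
no-independent-neighbour G none y y∈I = ¬-not λ w∼y → none (y , y∈I , w∼y)

module _ {n} (G : Graph n) {inK : Fin n → Bool} (P : SplitPartition G inK) where
  private
    clique : IsCliquePart G inK
    clique = proj₁ P
    independent : IsIndependentPart G inK
    independent = proj₂ P

  edge-meets-clique : ∀ {x y} → x ∼[ G ] y → inK x ≡ true ⊎ inK y ≡ true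
  edge-meets-clique {x} {y} x∼y with inK x in x∈? | inK y in y∈?
  ... | true  | _     = inj₁ refl
  ... | false | true  = inj₂ refl
  ... | false | false = contradiction (independent x y x∈? y∈?) (not-¬ x∼y)

  non-edge-meets-independent : ∀ {x y} → x ≢ y → x ≁[ G ] y → inK x ≡ false ⊎ inK y ≡ false
  non-edge-meets-independent {x} {y} x≢y x≁y with inK x in x∈? | inK y in y∈?
  ... | false | _     = inj₁ refl
  ... | true  | false = inj₂ refl
  ... | true  | true  = contradiction x≁y (not-¬ (clique x y x≢y x∈? y∈?))

  no-induced-2K₂ : ∀ {a b c d} → a ∼[ G ] b → c ∼[ G ] d →
                   a ≢ c → a ≢ d → b ≢ c → b ≢ d →
                   a ≁[ G ] c → a ≁[ G ] d → b ≁[ G ] c → b ≁[ G ] d → ⊥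
  no-induced-2K₂ {a} {b} {c} {d} a∼b c∼d a≢c a≢d b≢c b≢d a≁c a≁d b≁c b≁d
    with edge-meets-clique a∼b | edge-meets-clique c∼d
  ... | inj₁ a∈K | inj₁ c∈K = not-¬ (clique a c a≢c a∈K c∈K) a≁c
  ... | inj₁ a∈K | inj₂ d∈K = not-¬ (clique a d a≢d a∈K d∈K) a≁d
  ... | inj₂ b∈K | inj₁ c∈K = not-¬ (clique b c b≢c b∈K c∈K) b≁c
  ... | inj₂ b∈K | inj₂ d∈K = not-¬ (clique b d b≢d b∈K d∈K) b≁d

  no-induced-C₄ : ∀ {a b c d} → a ≢ b → c ≢ d → a ≁[ G ] b → c ≁[ G ] d →
                  a ∼[ G ] c → a ∼[ G ] d → b ∼[ G ] c → b ∼[ G ] d → ⊥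
  no-induced-C₄ {a} {b} {c} {d} a≢b c≢d a≁b c≁d a∼c a∼d b∼c b∼d
    with non-edge-meets-independent a≢b a≁b | non-edge-meets-independent c≢d c≁d
  ... | inj₁ a∈I | inj₁ c∈I = not-¬ a∼c (independent a c a∈I c∈I)
  ... | inj₁ a∈I | inj₂ d∈I = not-¬ a∼d (independent a d a∈I d∈I)
  ... | inj₂ b∈I | inj₁ c∈I = not-¬ b∼c (independent b c b∈I c∈I)
  ... | inj₂ b∈I | inj₂ d∈I = not-¬ b∼d (independent b d b∈I d∈I)

  move-to-independent : ∀ w → (∀ y → inK y ≡ false → w ≁[ G ] y) →
                        SplitPartition G (updateAt inK w (const false))
  move-to-independent w w≁I = clique′ , independent′
    where
    inK′ : Fin n → Bool
    inK′ = updateAt inK w (const false)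

    clique′ : IsCliquePart G inK′
    clique′ x y x≢y x∈K′ y∈K′ with updateAt-const-≡ inK w x x∈K′ | updateAt-const-≡ inK w y y∈K′
    ... | inj₁ (_ , ())     | _
    ... | inj₂ _            | inj₁ (_ , ())
    ... | inj₂ (_ , x∈K)    | inj₂ (_ , y∈K) = clique x y x≢y x∈K y∈K

    independent′ : IsIndependentPart G inK′
    independent′ x y x∈I′ y∈I′ with updateAt-const-≡ inK w x x∈I′ | updateAt-const-≡ inK w y y∈I′
    ... | inj₁ (refl , _)   | inj₁ (refl , _)  = irrefl G x
    ... | inj₁ (refl , _)   | inj₂ (_ , y∈I)   = w≁I y y∈I
    ... | inj₂ (_ , x∈I)    | inj₁ (refl , _)  = trans (Graph.sym G x y) (w≁I x x∈I)
    ... | inj₂ (_ , x∈I)    | inj₂ (_ , y∈I)   = independent x y x∈I y∈I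

  move-to-clique : ∀ c → (∀ x → inK x ≡ true → x ≢ c → x ∼[ G ] c) →
                   SplitPartition G (updateAt inK c (const true))
  move-to-clique c K∼c = clique′ , independent′
    where
    inK′ : Fin n → Bool
    inK′ = updateAt inK c (const true)

    clique′ : IsCliquePart G inK′
    clique′ x y x≢y x∈K′ y∈K′ with updateAt-const-≡ inK c x x∈K′ | updateAt-const-≡ inK c y y∈K′
    ... | inj₁ (refl , _)   | inj₁ (refl , _)  = contradiction refl x≢y
    ... | inj₁ (refl , _)   | inj₂ (y≢c , y∈K) = trans (Graph.sym G x y) (K∼c y y∈K y≢c)
    ... | inj₂ (x≢c , x∈K)  | inj₁ (refl , _)  = K∼c x x∈K x≢c
    ... | inj₂ (_ , x∈K)    | inj₂ (_ , y∈K)   = clique x y x≢y x∈K y∈K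

    independent′ : IsIndependentPart G inK′
    independent′ x y x∈I′ y∈I′ with updateAt-const-≡ inK c x x∈I′ | updateAt-const-≡ inK c y y∈I′
    ... | inj₁ (_ , ())     | _
    ... | inj₂ _            | inj₁ (_ , ())
    ... | inj₂ (_ , x∈I)    | inj₂ (_ , y∈I)   = independent x y x∈I y∈I

module _ {n} (G : Graph n) (u v : Fin n) where
  private
    G′ : Graph n
    G′ = deleteEdge G u v

  samePair-avoidingˡ : ∀ {x y} → x ≢ u → y ≢ u → samePair u v x y ≡ false
  samePair-avoidingˡ {x} {y} x≢u y≢u with x ≟ u | y ≟ u
  ... | yes x≡u | _       = contradiction x≡u x≢u
  ... | no _    | yes y≡u = contradiction y≡u y≢u
  ... | no _    | no _    = ∧-zeroʳ _

  samePair-avoidingʳ : ∀ {x y} → x ≢ v → y ≢ v → samePair u v x y ≡ false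
  samePair-avoidingʳ {x} {y} x≢v y≢v with x ≟ v | y ≟ v
  ... | yes x≡v | _       = contradiction x≡v x≢v
  ... | no _    | yes y≡v = contradiction y≡v y≢v
  ... | no _    | no _    = cong (_∨ false) (∧-zeroʳ _)

  samePair-avoiding : ∀ {w x y} → w ≡ u ⊎ w ≡ v → x ≢ w → y ≢ w → samePair u v x y ≡ false
  samePair-avoiding (inj₁ refl) = samePair-avoidingˡ
  samePair-avoiding (inj₂ refl) = samePair-avoidingʳ

  deleteEdge-∼ : ∀ {w x y} → w ≡ u ⊎ w ≡ v → x ≢ w → y ≢ w → x ∼[ G ] y → x ∼[ G′ ] y
  deleteEdge-∼ {x = x} {y} w∈uv x≢w y≢w x∼y =
    trans (cong (λ b → if b then false else adj G x y) (samePair-avoiding w∈uv x≢w y≢w)) x∼y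

  deleteEdge-≁ : ∀ {x y} → x ≁[ G ] y → x ≁[ G′ ] y
  deleteEdge-≁ {x} {y} x≁y with samePair u v x y
  ... | true  = refl
  ... | false = x≁y

  deleteEdge-removes : u ≁[ G′ ] v
  deleteEdge-removes with u ≟ u | v ≟ v
  ... | yes _  | yes _  = refl
  ... | no u≢u | _      = contradiction refl u≢u
  ... | yes _  | no v≢v = contradiction refl v≢v

  deleteEdge-preserves-partition : ∀ {inK w} → w ≡ u ⊎ w ≡ v → inK w ≡ false →
                                   SplitPartition G inK → SplitPartition G′ inK
  deleteEdge-preserves-partition {inK} w∈uv w∈I (clique , independent) = clique′ , independent′
    where
    clique′ : IsCliquePart G′ inK
    clique′ x y x≢y x∈K y∈K =
      deleteEdge-∼ w∈uv (≢-by inK x∈K w∈I) (≢-by inK y∈K w∈I) (clique x y x≢y x∈K y∈K)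

    independent′ : IsIndependentPart G′ inK
    independent′ x y x∈I y∈I = deleteEdge-≁ (independent x y x∈I y∈I)

  deleteEdge-isSplit-if-no-independent-neighbour :
    ∀ {inK w} → w ≡ u ⊎ w ≡ v → ¬ ∃ (IndependentNeighbour G inK w) →
    SplitPartition G inK → IsSplit G′
  deleteEdge-isSplit-if-no-independent-neighbour {inK} {w} w∈uv none P =
    updateAt inK w (const false) ,
    deleteEdge-preserves-partition w∈uv (updateAt-updates w inK)
      (move-to-independent G P w (no-independent-neighbour G none))

  P₄-middle-edge-deletion-not-split : MiddleEdgeOfInducedP4 G u v → ¬ IsSplit G′
  P₄-middle-edge-deletion-not-split
    (a , b , (a≢u , a≢v , a≢b , u≢v , u≢b , v≢b) , (a∼u , _ , v∼b) , (a≁v , a≁b , u≁b)) (_ , P) =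
    no-induced-2K₂ G′ P
      (deleteEdge-∼ (inj₂ refl) a≢v u≢v a∼u) (deleteEdge-∼ (inj₁ refl) (≢-sym u≢v) (≢-sym u≢b) v∼b)
      a≢v a≢b u≢v u≢b (deleteEdge-≁ a≁v) (deleteEdge-≁ a≁b) deleteEdge-removes (deleteEdge-≁ u≁b)

  diamond-middle-edge-deletion-not-split : MiddleEdgeOfInducedDiamond G u v → ¬ IsSplit G′
  diamond-middle-edge-deletion-not-split
    (a , b , (a≢u , a≢v , a≢b , u≢v , u≢b , v≢b) , (_ , u∼a , u∼b , v∼a , v∼b) , a≁b) (_ , P) =
    no-induced-C₄ G′ P u≢v a≢b deleteEdge-removes (deleteEdge-≁ a≁b)
      (deleteEdge-∼ (inj₂ refl) u≢v a≢v u∼a) (deleteEdge-∼ (inj₂ refl) u≢v (≢-sym v≢b) u∼b)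
      (deleteEdge-∼ (inj₁ refl) (≢-sym u≢v) a≢u v∼a) (deleteEdge-∼ (inj₁ refl) (≢-sym u≢v) (≢-sym u≢b) v∼b)

  module _ (u∼v : u ∼[ G ] v) (no-P₄ : ¬ MiddleEdgeOfInducedP4 G u v)
           (no-diamond : ¬ MiddleEdgeOfInducedDiamond G u v) where

    module _ {inK : Fin n → Bool} (P : SplitPartition G inK)
             (u∈K : inK u ≡ true) (v∈K : inK v ≡ true) where

      induced-P₄ : ∀ {a b} → inK a ≡ false → inK b ≡ false → u ∼[ G ] a → v ∼[ G ] b →
                   v ≁[ G ] a → u ≁[ G ] b → MiddleEdgeOfInducedP4 G u v
      induced-P₄ {a} {b} a∈I b∈I u∼a v∼b v≁a u≁b =
        a , b ,
        (≢-sym (≢-by inK u∈K a∈I) , ≢-sym (≢-by inK v∈K a∈I) , ≢-by (adj G u) u∼a u≁b ,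
         adjacent⇒≢ G u∼v , ≢-by inK u∈K b∈I , ≢-by inK v∈K b∈I) ,
        (trans (Graph.sym G a u) u∼a , u∼v , v∼b) ,
        (trans (Graph.sym G a v) v≁a , proj₂ P a b a∈I b∈I , u≁b)

      induced-diamond : ∀ {a b} → inK a ≡ false → a ≢ b → b ≢ u → b ≢ v →
                        u ∼[ G ] a → v ∼[ G ] a → u ∼[ G ] b → v ∼[ G ] b → a ≁[ G ] b →
                        MiddleEdgeOfInducedDiamond G u v
      induced-diamond {a} {b} a∈I a≢b b≢u b≢v u∼a v∼a u∼b v∼b a≁b =
        a , b ,
        (≢-sym (≢-by inK u∈K a∈I) , ≢-sym (≢-by inK v∈K a∈I) , a≢b ,
         adjacent⇒≢ G u∼v , ≢-sym b≢u , ≢-sym b≢v) ,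
        (u∼v , u∼a , u∼b , v∼a , v∼b) ,
        a≁b

      split-without-common-independent-neighbour :
        (∀ c → inK c ≡ false → u ∼[ G ] c → v ∼[ G ] c → ⊥) → IsSplit G′
      split-without-common-independent-neighbour no-common
        with any? (independentNeighbour? G inK u)
      ... | no u-has-none = deleteEdge-isSplit-if-no-independent-neighbour (inj₁ refl) u-has-none P
      ... | yes (a , a∈I , u∼a) with any? (independentNeighbour? G inK v)
      ... | no v-has-none = deleteEdge-isSplit-if-no-independent-neighbour (inj₂ refl) v-has-none P
      ... | yes (b , b∈I , v∼b) =
        ⊥-elim (no-P₄ (induced-P₄ a∈I b∈I u∼a v∼b
                        (¬-not λ v∼a → no-common a a∈I u∼a v∼a)
                        (¬-not λ u∼b → no-common b b∈I u∼b v∼b)))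

    split-with-common-independent-neighbour :
      ∀ {inK c} → SplitPartition G inK → inK u ≡ true → inK v ≡ true →
      inK c ≡ false → u ∼[ G ] c → v ∼[ G ] c → IsSplit G′
    split-with-common-independent-neighbour {inK} {c} P@(clique , independent) u∈K v∈K c∈I u∼c v∼c =
      split-without-common-independent-neighbour (move-to-clique G P c K∼c)
        (stays-in-K u∈K) (stays-in-K v∈K) no-other-common
      where
      stays-in-K : ∀ {x} → inK x ≡ true → updateAt inK c (const true) x ≡ true
      stays-in-K {x} x∈K = trans (updateAt-minimal x c inK (≢-by inK x∈K c∈I)) x∈K

      K∼c : ∀ x → inK x ≡ true → x ≢ c → x ∼[ G ] c
      K∼c x x∈K x≢c with x ≟ u | x ≟ v
      ... | yes refl | _        = u∼c
      ... | no _     | yes refl = v∼c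
      ... | no x≢u   | no x≢v   =
        ¬-not λ x≁c → no-diamond (induced-diamond P u∈K v∈K c∈I (≢-sym x≢c) x≢u x≢v u∼c v∼c
                                   (clique u x (≢-sym x≢u) u∈K x∈K) (clique v x (≢-sym x≢v) v∈K x∈K)
                                   (trans (Graph.sym G c x) x≁c))

      no-other-common : ∀ c′ → updateAt inK c (const true) c′ ≡ false →
                        u ∼[ G ] c′ → v ∼[ G ] c′ → ⊥
      no-other-common c′ c′∈I′ u∼c′ v∼c′ with updateAt-const-≡ inK c c′ c′∈I′
      ... | inj₁ (_ , ())
      ... | inj₂ (c′≢c , c′∈I) =
        no-diamond (induced-diamond P u∈K v∈K c∈I (≢-sym c′≢c)
                      (≢-sym (≢-by inK u∈K c′∈I)) (≢-sym (≢-by inK v∈K c′∈I))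
                      u∼c v∼c u∼c′ v∼c′ (independent c c′ c∈I c′∈I))

    deleteEdge-isSplit : IsSplit G → IsSplit G′
    deleteEdge-isSplit (inK , P) with inK u in u∈? | inK v in v∈?
    ... | false | _     = inK , deleteEdge-preserves-partition (inj₁ refl) u∈? P
    ... | true  | false = inK , deleteEdge-preserves-partition (inj₂ refl) v∈? P
    ... | true  | true  with any? (λ c → independentNeighbour? G inK u c ×-dec (adj G v c Bool.≟ true))
    ... | yes (c , (c∈I , u∼c) , v∼c) = split-with-common-independent-neighbour P u∈? v∈? c∈I u∼c v∼c
    ... | no none = split-without-common-independent-neighbour P u∈? v∈?
                      λ c c∈I u∼c v∼c → none (c , (c∈I , u∼c) , v∼c)

lemma4p2 : ∀ {n} (G : Graph n) → IsSplit G → (u v : Fin n) → u ∼[ G ] v →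
    (IsSplit (deleteEdge G u v)
    ⇔ (¬ (MiddleEdgeOfInducedP4 G u v ⊎ MiddleEdgeOfInducedDiamond G u v)))
lemma4p2 G G-split u v u∼v = mk⇔ forward backward
  where
  forward : IsSplit (deleteEdge G u v) →
            ¬ (MiddleEdgeOfInducedP4 G u v ⊎ MiddleEdgeOfInducedDiamond G u v)
  forward G′-split (inj₁ P₄)      = P₄-middle-edge-deletion-not-split G u v P₄ G′-split
  forward G′-split (inj₂ diamond) = diamond-middle-edge-deletion-not-split G u v diamond G′-split

  backward : ¬ (MiddleEdgeOfInducedP4 G u v ⊎ MiddleEdgeOfInducedDiamond G u v) →
             IsSplit (deleteEdge G u v)
  backward neither = deleteEdge-isSplit G u v u∼v (neither ∘ inj₁) (neither ∘ inj₂) G-split
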